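{- Let $f:\mathbb{N}\to\mathbb{N}$ satisfy $f(n)\le\lfloor\sqrt n\rfloor$ for every $n$. Then for every $n\ge1$ and every integer $i$ with $0\le i\le \frac{f^*(n)}{2}$, we have $f^{(i)}(n)\ge f^*(n)$.
   Context: $f^{(i)}$ denotes the $i$-fold composition of $f$ with itself ($f^{(0)}$ is the identity), and $f^*(n)=\min\{i: f^{(i)}(n)\le1\}$. -}

module Defs where

open import Data.Nat using (ℕ; zero; suc; _*_; _≤_; _<_)
open import Data.Product using (_×_)

iter : (ℕ → ℕ) → ℕ → ℕ → ℕ
iter f zero    n = n
iter f (suc i) n = f (iter f i n)

IsFloorSqrt : ℕ → ℕ → Set
IsFloorSqrt n r = (r * r ≤ n) × (n < suc r * suc r)

-- f*(n) = k : k is the least i with f^{(i)}(n) ≤ 1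
IsIterLog : (ℕ → ℕ) → ℕ → ℕ → Set
IsIterLog f n k = (iter f k n ≤ 1) × (∀ i → i < k → 1 < iter f i n)

{-# OPTIONS --safe #-}
-- Since f(m)² ≤ m, a value from which the iterates stay above 1 for s more steps is at
-- least 2s: stepping back from b ≥ max(2, 2s) gives at least b² ≥ 2b ≥ 2 + 2s. By
-- minimality of k = f*(n), the iterates starting at f^{(i)}(n) stay above 1 for k − i
-- steps, and k − i ≥ k/2 when 2i ≤ k.
module Submission where

open import Defs
open import Data.Nat using (ℕ; zero; suc; _+_; _∸_; _*_; _≤_; _<_; z≤n; z<s; s<s; _≤?_)
open import Data.Nat.Properties
open import Data.Product using (∃; _,_)
open import Function using (_∘_)
open import Relation.Nullary using (yes; no)
open import Relation.Binary.PropositionalEquality using (_≡_; cong; subst)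

floor-sqrt : ∀ m → ∃ (IsFloorSqrt m)
floor-sqrt zero = 0 , z≤n , z<s
floor-sqrt (suc m) with floor-sqrt m
... | r , r²≤m , m<[1+r]² with suc r * suc r ≤? suc m
...   | yes [1+r]²≤1+m =
  suc r , [1+r]²≤1+m , ≤-<-trans m<[1+r]² (*-mono-< (n<1+n (suc r)) (n<1+n (suc r)))
...   | no  [1+r]²≰1+m = r , m≤n⇒m≤1+n r²≤m , ≰⇒> [1+r]²≰1+m

SquareDominated : (ℕ → ℕ) → Set
SquareDominated a = ∀ t → a (suc t) * a (suc t) ≤ a t

2*m≡m+m : ∀ m → 2 * m ≡ m + m
2*m≡m+m m = cong (m +_) (+-identityʳ m)

2+n≤m*m : ∀ {m n} → 2 ≤ m → n ≤ m → 2 + n ≤ m * m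
2+n≤m*m {m} {n} 2≤m n≤m = begin
  2 + n  ≤⟨ +-mono-≤ 2≤m n≤m ⟩
  m + m  ≡⟨ 2*m≡m+m m ⟨
  2 * m  ≤⟨ *-monoˡ-≤ m 2≤m ⟩
  m * m  ∎
  where open ≤-Reasoning

above-1-for-s-steps⇒2*s≤head : ∀ {a} → SquareDominated a →
                               ∀ s → (∀ t → t < s → 1 < a t) → 2 * s ≤ a 0
above-1-for-s-steps⇒2*s≤head _ zero _ = z≤n
above-1-for-s-steps⇒2*s≤head _ (suc zero) above = above 0 z<s
above-1-for-s-steps⇒2*s≤head {a} dom (suc s@(suc _)) above = begin
  2 * suc s        ≡⟨ *-distribˡ-+ 2 1 s ⟩
  2 + 2 * s        ≤⟨ 2+n≤m*m (above 1 (s<s z<s))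
                        (above-1-for-s-steps⇒2*s≤head (dom ∘ suc) s (λ t t<s → above (suc t) (s<s t<s))) ⟩
  a 1 * a 1        ≤⟨ dom 0 ⟩
  a 0              ∎
  where open ≤-Reasoning

n≤2*[n∸m] : ∀ {m n} → 2 * m ≤ n → n ≤ 2 * (n ∸ m)
n≤2*[n∸m] {m} {n} 2m≤n = begin
  n                  ≡⟨ m+[n∸m]≡n (m+n≤o⇒m≤o m m+m≤n) ⟨
  m + (n ∸ m)        ≤⟨ +-monoˡ-≤ (n ∸ m) (m+n≤o⇒m≤o∸n m m+m≤n) ⟩
  (n ∸ m) + (n ∸ m)  ≡⟨ 2*m≡m+m (n ∸ m) ⟨
  2 * (n ∸ m)        ∎
  where
  open ≤-Reasoning
  m+m≤n : m + m ≤ n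
  m+m≤n = subst (_≤ n) (2*m≡m+m m) 2m≤n

f[m]*f[m]≤m : ∀ {f : ℕ → ℕ} → (∀ n r → IsFloorSqrt n r → f n ≤ r) → ∀ m → f m * f m ≤ m
f[m]*f[m]≤m {f} f≤⌊√⌋ m with floor-sqrt m
... | r , r²≤m , m<[1+r]² = ≤-trans (*-mono-≤ f[m]≤r f[m]≤r) r²≤m
  where
  f[m]≤r : f m ≤ r
  f[m]≤r = f≤⌊√⌋ m r (r²≤m , m<[1+r]²)

lemmaB3 : (f : ℕ → ℕ) → (∀ n r → IsFloorSqrt n r → f n ≤ r) →
          ∀ n → 1 ≤ n → ∀ k → IsIterLog f n k →
          ∀ i → 2 * i ≤ k → k ≤ iter f i n
lemmaB3 f f≤⌊√⌋ n _ k (_ , minimal) i 2i≤k = begin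
  k            ≤⟨ n≤2*[n∸m] {i} 2i≤k ⟩
  2 * (k ∸ i)  ≤⟨ above-1-for-s-steps⇒2*s≤head (λ t → f[m]*f[m]≤m f≤⌊√⌋ (iter f (t + i) n)) (k ∸ i) above-1 ⟩
  iter f i n   ∎
  where
  open ≤-Reasoning
  above-1 : ∀ t → t < k ∸ i → 1 < iter f (t + i) n
  above-1 t t<k∸i = minimal (t + i) (m≤o∸n⇒m+n≤o (suc t) (m+n≤o⇒m≤o i 2i≤k) t<k∸i)
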